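{- Let $F,F'$ be integral binary cubic forms such that $R(F')\subset R(F)$ (a subring of finite index). Then there exists a matrix $\delta\in M_2(\mathbb{Z})$ such that $|\det\delta|=(R(F):R(F'))$ and $F'=\delta\cdot F$.
   Context: For an integral binary cubic form $F(u)=au_1^3+bu_1^2u_2+cu_1u_2^2+du_2^3$, $R(F)$ is the ring with $\mathbb{Z}$-basis $\{1,\omega,\theta\}$ and multiplication $\omega^2=-ac+b\omega-a\theta$, $\theta^2=-bd+d\omega-c\theta$, $\omega\theta=-ad$ (Delone–Faddeev correspondence). For $\delta\in M_2(\mathbb{Z})$ with $\det\delta\ne0$, $(\delta\cdot F)(u)=(\det\delta)^{ -1}F(u\delta)$, where $u=(u_1,u_2)$ is a row vector. -}

module Defs where

open import Data.Integer using (ℤ; _+_; _*_; -_; _-_; ∣_∣; 0ℤ; 1ℤ)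
open import Data.Nat using (ℕ)
open import Data.Product using (Σ; _×_; _,_)
open import Relation.Binary.PropositionalEquality using (_≡_; _≢_)

record BCF : Set where
  constructor bcf
  field
    a b c d : ℤ

eval : BCF → ℤ → ℤ → ℤ
eval (bcf a b c d) u1 u2 =
  a * (u1 * u1 * u1) + b * (u1 * u1 * u2) + c * (u1 * u2 * u2) + d * (u2 * u2 * u2)

record M2 : Set where
  constructor m2
  field
    p q r s : ℤ

det2 : M2 → ℤ
det2 (m2 p q r s) = p * s - q * r

-- F(u δ) for the row vector u = (u1 , u2)
evalAt : BCF → M2 → ℤ → ℤ → ℤ
evalAt F (m2 p q r s) u1 u2 = eval F (u1 * p + u2 * r) (u1 * q + u2 * s)

-- F' = δ · F, i.e. F'(u) = (det δ)^{-1} F(u δ) for all u, written without division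
_≡δ·_ : BCF → (M2 × BCF) → Set
F' ≡δ· (δ , F) = ∀ u1 u2 → det2 δ * eval F' u1 u2 ≡ evalAt F δ u1 u2

-- Elements of R(F): coordinates (x0 , x1 , x2) w.r.t. the Z-basis {1 , ω , θ}
record Elt : Set where
  constructor elt
  field
    x0 x1 x2 : ℤ

one : Elt
one = elt 1ℤ 0ℤ 0ℤ

_⊕_ : Elt → Elt → Elt
elt x0 x1 x2 ⊕ elt y0 y1 y2 = elt (x0 + y0) (x1 + y1) (x2 + y2)

scale : ℤ → Elt → Elt
scale k (elt x0 x1 x2) = elt (k * x0) (k * x1) (k * x2)

-- Multiplication of R(F):
--   ω² = -ac + bω - aθ ,  θ² = -bd + dω - cθ ,  ωθ = -ad
mul : BCF → Elt → Elt → Elt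
mul (bcf a b c d) (elt x0 x1 x2) (elt y0 y1 y2) =
  elt (x0 * y0 - a * c * (x1 * y1) - a * d * (x1 * y2 + x2 * y1) - b * d * (x2 * y2))
      (x0 * y1 + x1 * y0 + b * (x1 * y1) + d * (x2 * y2))
      (x0 * y2 + x2 * y0 - a * (x1 * y1) - c * (x2 * y2))

linMap : Elt → Elt → Elt → Elt → Elt
linMap e0 e1 e2 (elt x0 x1 x2) = (scale x0 e0 ⊕ scale x1 e1) ⊕ scale x2 e2

det3 : Elt → Elt → Elt → ℤ
det3 (elt a0 a1 a2) (elt b0 b1 b2) (elt c0 c1 c2) =
  a0 * (b1 * c2 - b2 * c1) - b0 * (a1 * c2 - a2 * c1) + c0 * (a1 * b2 - a2 * b1)

-- An embedding of R(F') as a subring of finite index of R(F), given by the images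
-- e0 , e1 , e2 of the basis 1 , ω' , θ': a unital ring homomorphism (additivity is
-- built in) that is injective with finite-index image (det ≠ 0).
record SubringEmbedding (F' F : BCF) : Set where
  field
    e0 e1 e2  : Elt
    unital    : linMap e0 e1 e2 one ≡ one
    multiplicative : ∀ x y →
      linMap e0 e1 e2 (mul F' x y) ≡ mul F (linMap e0 e1 e2 x) (linMap e0 e1 e2 y)
    finiteIndex : det3 e0 e1 e2 ≢ 0ℤ

-- the index (R(F) : R(F')) of the image lattice = |det| of the embedding matrix
index : ∀ {F' F} → SubringEmbedding F' F → ℕ
index φ = ∣ det3 (SubringEmbedding.e0 φ) (SubringEmbedding.e1 φ) (SubringEmbedding.e2 φ) ∣

{-# OPTIONS --safe #-}
module Submission where

-- Since φ(1) = 1, the embedding induces a map R(F')/ℤ → R(F)/ℤ, whose matrix δ in the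
-- bases ω', θ' and ω, θ has determinant the index.  The form is recovered from its ring:
-- for x = x₀ + x₁ω + x₂θ, the 2×2 minor of the ω, θ-coordinates of x and x² is −F(x₁, x₂).
-- Applying φ to ξ = u₁ω' + u₂θ' multiplies this minor by det δ, so det δ · F'(u) = F(uδ).

open import Defs
open import Data.Integer using (ℤ; ∣_∣; _+_; _*_; _-_; -_; 0ℤ; 1ℤ)
open import Data.Integer.Properties using (neg-injective; neg-distribʳ-*)
open import Data.Integer.Tactic.RingSolver using (solve-∀)
open import Data.Product using (Σ; _×_; _,_; uncurry)
open import Relation.Binary.PropositionalEquality using (_≡_; refl; cong; cong₂; sym; trans; module ≡-Reasoning)

ωθ : Elt → ℤ × ℤ
ωθ (elt _ x1 x2) = x1 , x2

_∧_ : ℤ × ℤ → ℤ × ℤ → ℤ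
(x1 , x2) ∧ (y1 , y2) = x1 * y2 - x2 * y1

_·_ : ℤ × ℤ → M2 → ℤ × ℤ
(u1 , u2) · m2 p q r s = u1 * p + u2 * r , u1 * q + u2 * s

∧-· : ∀ u v δ → (u · δ) ∧ (v · δ) ≡ det2 δ * (u ∧ v)
∧-· (u1 , u2) (v1 , v2) (m2 p q r s) = identity u1 u2 v1 v2 p q r s
  where
  identity : ∀ u1 u2 v1 v2 p q r s →
    (u1 * p + u2 * r) * (v1 * q + v2 * s) - (u1 * q + u2 * s) * (v1 * p + v2 * r)
      ≡ (p * s - q * r) * (u1 * v2 - u2 * v1)
  identity = solve-∀

ωθ-square : ∀ F x → ωθ x ∧ ωθ (mul F x x) ≡ - uncurry (eval F) (ωθ x)
ωθ-square (bcf a b c d) (elt x0 x1 x2) = identity a b c d x0 x1 x2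
  where
  identity : ∀ a b c d x0 x1 x2 →
    x1 * (x0 * x2 + x2 * x0 - a * (x1 * x1) - c * (x2 * x2))
      - x2 * (x0 * x1 + x1 * x0 + b * (x1 * x1) + d * (x2 * x2))
      ≡ - (a * (x1 * x1 * x1) + b * (x1 * x1 * x2) + c * (x1 * x2 * x2) + d * (x2 * x2 * x2))
  identity = solve-∀

quotientMatrix : Elt → Elt → M2
quotientMatrix e1 e2 = m2 (Elt.x1 e1) (Elt.x2 e1) (Elt.x1 e2) (Elt.x2 e2)

ωθ-linMap : ∀ e0 e1 e2 x → ωθ e0 ≡ (0ℤ , 0ℤ) →
  ωθ (linMap e0 e1 e2 x) ≡ ωθ x · quotientMatrix e1 e2
ωθ-linMap (elt _ _ _) (elt _ α1 α2) (elt _ β1 β2) (elt x0 x1 x2) refl =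
  cong₂ _,_ (identity x0 x1 x2 α1 β1) (identity x0 x1 x2 α2 β2)
  where
  identity : ∀ x0 x1 x2 α β → x0 * 0ℤ + x1 * α + x2 * β ≡ x1 * α + x2 * β
  identity = solve-∀

elt-cong : ∀ {x0 x1 x2 y0 y1 y2} → x0 ≡ y0 → x1 ≡ y1 → x2 ≡ y2 → elt x0 x1 x2 ≡ elt y0 y1 y2
elt-cong refl refl refl = refl

linMap-one : ∀ e0 e1 e2 → linMap e0 e1 e2 one ≡ e0
linMap-one (elt g0 g1 g2) (elt α0 α1 α2) (elt β0 β1 β2) =
  elt-cong (identity g0 α0 β0) (identity g1 α1 β1) (identity g2 α2 β2)
  where
  identity : ∀ g α β → 1ℤ * g + 0ℤ * α + 0ℤ * β ≡ g
  identity = solve-∀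

det3-one : ∀ e1 e2 → det3 one e1 e2 ≡ det2 (quotientMatrix e1 e2)
det3-one (elt α0 α1 α2) (elt β0 β1 β2) = identity α0 α1 α2 β0 β1 β2
  where
  identity : ∀ α0 α1 α2 β0 β1 β2 →
    1ℤ * (α1 * β2 - α2 * β1) - α0 * (0ℤ * β2 - 0ℤ * β1) + β0 * (0ℤ * α2 - 0ℤ * α1)
      ≡ α1 * β2 - α2 * β1
  identity = solve-∀

module _ {F' F : BCF} (φ : SubringEmbedding F' F) where
  open SubringEmbedding φ

  inducedMatrix : M2
  inducedMatrix = quotientMatrix e1 e2

  e0≡one : e0 ≡ one
  e0≡one = trans (sym (linMap-one e0 e1 e2)) unital

  index≡∣det∣ : index φ ≡ ∣ det2 inducedMatrix ∣
  index≡∣det∣ = cong ∣_∣ (trans (cong (λ e → det3 e e1 e2) e0≡one) (det3-one e1 e2))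

  ωθ-embedding : ∀ x → ωθ (linMap e0 e1 e2 x) ≡ ωθ x · inducedMatrix
  ωθ-embedding x = ωθ-linMap e0 e1 e2 x (cong ωθ e0≡one)

  inducedMatrix-transforms : F' ≡δ· (inducedMatrix , F)
  inducedMatrix-transforms u1 u2 = neg-injective (begin
    - (det2 δ * eval F' u1 u2)                    ≡⟨ neg-distribʳ-* (det2 δ) (eval F' u1 u2) ⟩
    det2 δ * - eval F' u1 u2                      ≡⟨ cong (det2 δ *_) (sym (ωθ-square F' ξ)) ⟩
    det2 δ * (ωθ ξ ∧ ωθ ξ²)                       ≡⟨ sym (∧-· (ωθ ξ) (ωθ ξ²) δ) ⟩
    (ωθ ξ · δ) ∧ (ωθ ξ² · δ)                      ≡⟨ sym (cong₂ _∧_ (ωθ-embedding ξ) (ωθ-embedding ξ²)) ⟩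
    ωθ (ψ ξ) ∧ ωθ (ψ ξ²)                          ≡⟨ cong (λ y → ωθ (ψ ξ) ∧ ωθ y) (multiplicative ξ ξ) ⟩
    ωθ (ψ ξ) ∧ ωθ (mul F (ψ ξ) (ψ ξ))             ≡⟨ ωθ-square F (ψ ξ) ⟩
    - uncurry (eval F) (ωθ (ψ ξ))                 ≡⟨ cong (λ v → - uncurry (eval F) v) (ωθ-embedding ξ) ⟩
    - evalAt F δ u1 u2                            ∎)
    where
    open ≡-Reasoning
    δ : M2
    δ = inducedMatrix
    ψ : Elt → Elt
    ψ = linMap e0 e1 e2
    ξ ξ² : Elt
    ξ = elt 0ℤ u1 u2
    ξ² = mul F' ξ ξ

proposition2p3 : (F F' : BCF) → (φ : SubringEmbedding F' F) →
    Σ M2 (λ δ → (∣ det2 δ ∣ ≡ index φ) × (F' ≡δ· (δ , F)))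
proposition2p3 F F' φ = inducedMatrix φ , sym (index≡∣det∣ φ) , inducedMatrix-transforms φ
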